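{- Let $\mathcal I$ be an N$^4$ interpretation of $\mathcal L$, $\mathcal V$ a variable assignment with respect to $\mathcal I$, and $F$ a formula of $\mathcal L$ in prefix negation form such that $F\neq\neg^{2k+1}G$ for every $k\in\mathbb N$ and every formula $G$. If $\mathit{val}_{\mathcal I,\mathcal V}(F)=\mathbf{true}$, then $\mathit{val}_{\mathcal I,\mathcal V}(\neg^2F)=\mathbf{true}$.
   Context: Fix a first-order language $\mathcal L$ with a non-empty set of constants, function symbols, predicate symbols of arities $n\ge 0$, the falsum $\bot$ (which is not an atom), connectives $\neg,\wedge,\vee$ and quantifiers $\forall,\exists$. $\neg^n$ denotes $n$-fold negation, $\top:=\neg\bot$. A formula $F$ is in prefix negation form if $F=\neg^nG$ for some $n\ge0$ and some formula $G$ in which $\neg$ does not occur. An N$^4$ interpretation $\mathcal I=(D,\mathit{val})$ of $\mathcal L$ consists of a non-empty set $D$ and an assignment with $\mathit{val}(c)\in D$ for each constant $c$; $\mathit{val}(f):D^n\to D$ for each $n$-ary function symbol $f$; for each $0$-ary predicate symbol $p$, truth values $\mathit{val}(p),\mathit{val}(\neg^2 p)\in\{\mathbf{true},\mathbf{false}\}$ such that $\mathit{val}(p)=\mathbf{true}$ implies $\mathit{val}(\neg^2p)=\mathbf{true}$; for each $n$-ary predicate symbol $p$ ($n\ge1$), relations $\mathit{val}(p)\subseteq\mathit{val}(\neg^2 p)\subseteq D^n$. Variable assignments $\mathcal V$, $\mathcal V[d/x]$, and term values $\mathit{val}_{\mathcal I,\mathcal V}(t)$ are as in classical logic. Write $p(\bar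 t)$ for either a $0$-ary $p$ or $p(t_1,\dots,t_n)$, and say $p(\bar t)$ "holds in" $R$ if $R=\mathbf{true}$ (for $0$-ary $p$) or the tuple of values of $t_1,\dots,t_n$ lies in $R$. The valuation $\mathit{val}_{\mathcal I,\mathcal V}$ of formulas is given by: (1.1) $p(\bar t)$ is true iff it holds in $\mathit{val}(p)$; (1.2) $(F_1\wedge F_2)$ true iff both true; (1.3) $(F_1\vee F_2)$ true iff some $F_i$ true; (1.4) $\forall xF$ true iff $\mathit{val}_{\mathcal I,\mathcal V[d/x]}(F)=\mathbf{true}$ for all $d\in D$; (1.5) $\exists xF$ true iff so for some $d$; (2.1) $\neg\bot$ is true, and $\neg p(\bar t)$ is true iff $p(\bar t)$ is not true; (2.2) $\neg(F_1\wedge F_2)$ has the value of $(\neg F_1\vee\neg F_2)$; (2.3) $\neg(F_1\vee F_2)$ that of $(\neg F_1\wedge\neg F_2)$; (2.4) $\neg\forall xF$ that of $\exists x\neg F$; (2.5) $\neg\exists xF$ that of $\forall x\neg F$; (3.1) $\neg^2p(\bar t)$ true iff it holds in $\mathit{val}(\neg^2p)$; (3.2) $\neg^2(F_1\wedge F_2)$ has the value of $(\neg^2F_1\wedge\neg^2F_2)$; (3.3) $\neg^2(F_1\vee F_2)$ that of $(\neg^2F_1\vee\neg^2F_2)$; (3.4) $\neg^2\forall xF$ that of $\forall x\neg^2F$; (3.5) $\neg^2\exists xF$ that of $\exists x\neg^2F$; (4) for every formula $F$, $\neg^3F$ is true iff $\neg^2F$ is not true; (5) a formula is $\mathbf{false}$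 iff it is not made true by the clauses above. -}

module Defs where

open import Data.Nat using (ℕ; zero; suc; _≟_)
open import Data.Vec using (Vec; []; _∷_)
open import Data.Product using (Σ; _×_; _,_)
open import Data.Sum using (_⊎_)
open import Data.Empty using (⊥)
open import Data.Unit using (⊤)
open import Relation.Nullary using (¬_; yes; no)

record Signature : Set₁ where
  field
    Const  : Set
    someConst : Const
    Fun    : ℕ → Set
    Pred   : ℕ → Set

module _ (L : Signature) where
  open Signature L

  Var : Set
  Var = ℕ

  data Term : Set where
    var : Var → Term
    con : Const → Term
    app : ∀ {n} → Fun n → Vec Term n → Term

  data Formula : Set where
    atom : ∀ {n} → Pred n → Vec Term n → Formula
    ⊥ₗ   : Formula
    ¬ₗ_  : Formula → Formula
    _∧ₗ_ : Formula → Formula → Formula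
    _∨ₗ_ : Formula → Formula → Formula
    ∀ₗ   : Var → Formula → Formula
    ∃ₗ   : Var → Formula → Formula

  negs : ℕ → Formula → Formula
  negs zero    G = G
  negs (suc n) G = ¬ₗ (negs n G)

  data NegFree : Formula → Set where
    nf-atom : ∀ {n} (p : Pred n) (ts : Vec Term n) → NegFree (atom p ts)
    nf-⊥    : NegFree ⊥ₗ
    nf-∧    : ∀ {A B} → NegFree A → NegFree B → NegFree (A ∧ₗ B)
    nf-∨    : ∀ {A B} → NegFree A → NegFree B → NegFree (A ∨ₗ B)
    nf-∀    : ∀ {x A} → NegFree A → NegFree (∀ₗ x A)
    nf-∃    : ∀ {x A} → NegFree A → NegFree (∃ₗ x A)

  PrefixNegForm : Formula → Set
  PrefixNegForm F = Σ ℕ λ n → Σ Formula λ G → NegFree G × (F ≡ negs n G)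
    where open import Relation.Binary.PropositionalEquality using (_≡_)

  -- N⁴ interpretations. For a predicate of arity n, val(p) and val(¬²p) are
  -- relations on Dⁿ (for n = 0, a relation on D⁰ is just a truth value),
  -- with val(p) ⊆ val(¬²p).
  record N4Interp : Set₁ where
    field
      D       : Set
      valC    : Const → D
      valF    : ∀ {n} → Fun n → Vec D n → D
      valP    : ∀ {n} → Pred n → Vec D n → Set
      valNNP  : ∀ {n} → Pred n → Vec D n → Set
      valP⊆valNNP : ∀ {n} (p : Pred n) (ds : Vec D n) → valP p ds → valNNP p ds

  module _ (I : N4Interp) where
    open N4Interp I

    Assignment : Set
    Assignment = Var → D

    update : Assignment → Var → D → Assignment
    update V x d y with x ≟ y
    ... | yes _ = d
    ... | no  _ = V y

    mutual
      valT : Assignment → Term → D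
      valT V (var x)    = V x
      valT V (con c)    = valC c
      valT V (app f ts) = valF f (valTs V ts)

      valTs : ∀ {n} → Assignment → Vec Term n → Vec D n
      valTs V []       = []
      valTs V (t ∷ ts) = valT V t ∷ valTs V ts

    -- The valuation of the paper, "val(F) = true" rendered as the type
    -- valF0 V F being inhabited (clause (5): false iff not true).
    -- valF0 V F : truth of F; valF1 V F : truth of ¬F; valF2 V F : truth of ¬²F.
    mutual
      valF0 : Assignment → Formula → Set
      valF0 V (atom p ts) = valP p (valTs V ts)
      valF0 V ⊥ₗ          = ⊥
      valF0 V (¬ₗ G)      = valF1 V G
      valF0 V (A ∧ₗ B)    = valF0 V A × valF0 V B
      valF0 V (A ∨ₗ B)    = valF0 V A ⊎ valF0 V B
      valF0 V (∀ₗ x A)    = (d : D) → valF0 (update V x d) A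
      valF0 V (∃ₗ x A)    = Σ D λ d → valF0 (update V x d) A

      valF1 : Assignment → Formula → Set
      valF1 V (atom p ts) = ¬ valP p (valTs V ts)
      valF1 V ⊥ₗ          = ⊤
      valF1 V (¬ₗ G)      = valF2 V G
      valF1 V (A ∧ₗ B)    = valF1 V A ⊎ valF1 V B
      valF1 V (A ∨ₗ B)    = valF1 V A × valF1 V B
      valF1 V (∀ₗ x A)    = Σ D λ d → valF1 (update V x d) A
      valF1 V (∃ₗ x A)    = (d : D) → valF1 (update V x d) A

      valF2 : Assignment → Formula → Set
      valF2 V (atom p ts) = valNNP p (valTs V ts)
      valF2 V ⊥ₗ          = ⊥
      valF2 V (¬ₗ G)      = ¬ valF2 V G
      valF2 V (A ∧ₗ B)    = valF2 V A × valF2 V B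
      valF2 V (A ∨ₗ B)    = valF2 V A ⊎ valF2 V B
      valF2 V (∀ₗ x A)    = (d : D) → valF2 (update V x d) A
      valF2 V (∃ₗ x A)    = Σ D λ d → valF2 (update V x d) A

    IsTrue : Assignment → Formula → Set
    IsTrue V F = valF0 V F

{-# OPTIONS --safe #-}
module Submission where

open import Defs
open import Data.Nat using (ℕ; _+_; _*_; zero; suc)
open import Data.Product using (_,_)
open import Data.Sum using (inj₁; inj₂)
open import Relation.Nullary using (contradiction)
open import Relation.Binary.PropositionalEquality using (_≢_; refl)

-- Write F = ¬ⁿG with G negation-free. For n = 0, clauses (1.x) and (3.x)
-- have the same shape, so truth of G propagates to ¬²G from the atoms,
-- where val(p) ⊆ val(¬²p). For n ≥ 2, F = ¬²H and clause (4) makes ¬⁴H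
-- true iff ¬²H is not not true, so ¬²F follows from F by double-negation
-- introduction. Hence the parity hypothesis is only needed to rule out n = 1.

module _ {L : Signature} {I : N4Interp L} where

  negFree-true⇒¬²-true : ∀ {V G} → NegFree L G
    → IsTrue L I V G → IsTrue L I V (negs L 2 G)
  negFree-true⇒¬²-true (nf-atom p ts) t         = N4Interp.valP⊆valNNP I p _ t
  negFree-true⇒¬²-true nf-⊥           ()
  negFree-true⇒¬²-true (nf-∧ a b)     (s , t)   = negFree-true⇒¬²-true a s , negFree-true⇒¬²-true b t
  negFree-true⇒¬²-true (nf-∨ a b)     (inj₁ s)  = inj₁ (negFree-true⇒¬²-true a s)
  negFree-true⇒¬²-true (nf-∨ a b)     (inj₂ t)  = inj₂ (negFree-true⇒¬²-true b t)
  negFree-true⇒¬²-true (nf-∀ a)       t         = λ d → negFree-true⇒¬²-true a (t d)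
  negFree-true⇒¬²-true (nf-∃ a)       (d , t)   = d , negFree-true⇒¬²-true a t

  ¬²-true⇒¬⁴-true : ∀ {V} F → IsTrue L I V (negs L 2 F) → IsTrue L I V (negs L 4 F)
  ¬²-true⇒¬⁴-true F t = contradiction t

proposition4 : (L : Signature) (I : N4Interp L) (V : Assignment L I)
    (F : Formula L) → PrefixNegForm L F
    → (∀ (k : ℕ) (G : Formula L) → F ≢ negs L (2 * k + 1) G)
    → IsTrue L I V F → IsTrue L I V (negs L 2 F)
proposition4 L I V _ (zero , G , negFree , refl) _ = negFree-true⇒¬²-true negFree
proposition4 L I V _ (suc zero , G , _ , refl) notOdd = contradiction refl (notOdd 0 G)
proposition4 L I V _ (suc (suc n) , G , _ , refl) _ = ¬²-true⇒¬⁴-true (negs L n G)
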